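{- In an information state $X$, the propositional variable $q$ depends on $p_1,\dots,p_n$ iff the formula $\big(\bigwedge_{1\leq i\leq n}(\Box p_i\vee \Box \neg p_i) \big)\Rightarrow (\Box q\vee\Box\neg q)$ is true relative to $X$ according to the Kolodny--MacFarlane semantics for $\Rightarrow$.
   Context: Models are $\mathcal{M}=\langle W,V\rangle$; formulas of $\mathcal{L}(\Rightarrow)$ ($\varphi::= p\mid \neg\varphi\mid \varphi\wedge\varphi\mid \Box\varphi \mid \varphi\Rightarrow\varphi$, $\Diamond=\neg\Box\neg$) are evaluated at a world $w$ relative to an information state $X\subseteq W$: $p$ and Booleans as usual, $\mathcal{M},w,X\vDash\Box\varphi$ iff $\mathcal{M},v,X\vDash\varphi$ for all $v\in X$. Write $[\![\varphi]\!]^{\mathcal{M},X}=\{v\in X\mid \mathcal{M},v,X\vDash\varphi\}$. Kolodny--MacFarlane semantics: $\mathcal{M},w,X\vDash \varphi\Rightarrow\psi$ iff $\mathcal{M},w,X'\vDash \Box\psi$ for all $X'$ such that (i) $X'\subseteq X$, (ii) $X'\subseteq[\![\varphi]\!]^{\mathcal{M},X'}$, and (iii) there is no $X''$ satisfying (i) and (ii) with $X'\subsetneq X''$. In an information state $X$, $q$ depends on (supervenes on) $p_1,\dots,p_n$ iff any two worlds in $X$ that agree on the truth values of $p_1,\dots,p_n$ also agree on the truth value of $q$. (Truth of the formula relative to $X$ does not depend on the world $w$.) -}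

module Defs where

open import Level using (Level; 0ℓ) renaming (suc to lsuc)
open import Data.Nat using (ℕ)
open import Data.Bool using (Bool; true)
open import Data.Product using (_×_; Σ; ∃; _,_)
open import Data.Sum using (_⊎_)
open import Data.Empty using (⊥)
open import Data.List.NonEmpty using (List⁺; _∷_; toList)
open import Data.List.Membership.Propositional using (_∈_)
open import Data.List using (List; []; _∷_)
open import Relation.Nullary using (¬_)
open import Relation.Binary.PropositionalEquality using (_≡_)

Var : Set
Var = ℕ

infixr 6 _∧'_
infixr 4 _⇒_
data Form : Set where
  atom : Var → Form
  ¬'_  : Form → Form
  _∧'_ : Form → Form → Form
  □_   : Form → Form
  _⇒_  : Form → Form → Form

_∨'_ : Form → Form → Form
φ ∨' ψ = ¬' (¬' φ ∧' ¬' ψ)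

◇_ : Form → Form
◇ φ = ¬' (□ (¬' φ))

⋀ : List⁺ Form → Form
⋀ (φ ∷ φs) = go φ φs
  where
  go : Form → List Form → Form
  go φ [] = φ
  go φ (ψ ∷ ψs) = φ ∧' go ψ ψs

record Model : Set₁ where
  field
    W : Set
    V : Var → W → Bool
open Model public

State : Model → Set₁
State M = W M → Set

_⊆_ : {A : Set} → (A → Set) → (A → Set) → Set
X ⊆ Y = ∀ v → X v → Y v

_⊊_ : {A : Set} → (A → Set) → (A → Set) → Set
X ⊊ Y = X ⊆ Y × ∃ λ v → Y v × ¬ X v

-- Conditions (i)–(iii) of the Kolodny–MacFarlane clause, stated for an
-- arbitrary "φ is true at v relative to Y" relation S (S Y v).
-- Condition (ii): Y ⊆ [[φ]]^{M,Y}.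
SupportsBy : (M : Model) → (State M → W M → Set₁) → State M → Set₁
SupportsBy M S Y = ∀ v → Y v → S Y v

MaxAdmissibleBy : (M : Model) → (State M → W M → Set₁) → State M → State M → Set₁
MaxAdmissibleBy M S X X' =
  X' ⊆ X × SupportsBy M S X' ×
  (∀ (X'' : State M) → X'' ⊆ X → SupportsBy M S X'' → ¬ (X' ⊊ X''))

Sat : (M : Model) → W M → State M → Form → Set₁
Sat M w X (atom p) = Level.Lift _ (V M p w ≡ true)
Sat M w X (¬' φ)   = ¬ Sat M w X φ
Sat M w X (φ ∧' ψ) = Sat M w X φ × Sat M w X ψ
Sat M w X (□ φ)    = ∀ v → X v → Sat M v X φ
Sat M w X (φ ⇒ ψ)  =
  ∀ (X' : State M) → MaxAdmissibleBy M (λ Y v → Sat M v Y φ) X X' →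
  (∀ v → X' v → Sat M v X' ψ)      -- i.e. M , w , X' ⊨ □ψ

Supports : (M : Model) → State M → Form → Set₁
Supports M X φ = SupportsBy M (λ Y v → Sat M v Y φ) X

MaxAdmissible : (M : Model) → State M → Form → State M → Set₁
MaxAdmissible M X φ X' = MaxAdmissibleBy M (λ Y v → Sat M v Y φ) X X'

-- Truth of a formula relative to an information state X
-- (at every world w; the paper notes truth relative to X does not depend on w).
TrueIn : (M : Model) → State M → Form → Set₁
TrueIn M X φ = ∀ (w : W M) → Sat M w X φ

DependsOn : (M : Model) → State M → Var → List⁺ Var → Set
DependsOn M X q ps =
  ∀ w v → X w → X v →
  (∀ p → p ∈ toList ps → V M p w ≡ V M p v) →
  V M q w ≡ V M q v

settled : Var → Form
settled p = (□ (atom p)) ∨' (□ (¬' (atom p)))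

depFormula : Var → List⁺ Var → Form
depFormula q ps = ⋀ (Data.List.NonEmpty.map settled ps) ⇒ settled q

module Submission where

-- A formula  □p ∨ □¬p  ("p is settled") is true relative to an
-- information state Y exactly when all worlds of Y agree on p; hence the
-- antecedent  ⋀ᵢ (□pᵢ ∨ □¬pᵢ)  is supported by Y exactly when every pᵢ is
-- constant on Y.  In particular each cell of X under "agreeing on p₁,…,pₙ"
-- is a maximal such Y ⊆ X, and the consequent asks q to be constant on the
-- maximal ones.
--
--   (⇒)  If q depends on the pᵢ in X, it does so in every Y ⊆ X; on a Y where
--        all pᵢ are constant this forces q to be constant, i.e. settled.
--   (⇐)  Given w, v ∈ X agreeing on the pᵢ, the cell of w is a maximal
--        admissible state containing both; q is settled there, so w and v
--        agree on q.

open import Defs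
open import Level using (lift; lower)
open import Data.Bool using (true; false)
open import Data.Product using (_×_; _,_; proj₁)
open import Data.List using ([]; _∷_)
open import Data.List.NonEmpty as List⁺ using (List⁺; _∷_; toList)
open import Data.List.Relation.Unary.Any using (here; there)
open import Data.List.Membership.Propositional using (_∈_)
open import Data.Empty using (⊥-elim)
open import Function.Bundles using (_⇔_; mk⇔)
open import Relation.Nullary using (¬_)
open import Relation.Binary.PropositionalEquality using (_≡_; _≢_; refl; sym; trans)

module _ (M : Model) where

  Constant : State M → Var → Set
  Constant Y p = ∀ a b → Y a → Y b → V M p a ≡ V M p b

  AgreeOn : List⁺ Var → W M → W M → Set
  AgreeOn ps a b = ∀ r → r ∈ toList ps → V M r a ≡ V M r b

  true≢false : true ≢ false
  true≢false ()

  -- □p ∨ □¬p holds relative to Y only if p is constant on Y: two worlds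
  -- with different values would refute both disjuncts.
  settled⇒constant : ∀ {Y} v p → Sat M v Y (settled p) → Constant Y p
  settled⇒constant {Y = Y} v p settledP a b Ya Yb = compare (V M p a) (V M p b) refl refl
    where
    refuted : ∀ t f → Y t → Y f → V M p t ≡ true → V M p f ≡ false → V M p a ≡ V M p b
    refuted t f Yt Yf pt pf =
      ⊥-elim (settledP ( (λ boxP → true≢false (trans (sym (lower (boxP f Yf))) pf))
                       , (λ boxNotP → boxNotP t Yt (lift pt))))

    compare : ∀ x y → V M p a ≡ x → V M p b ≡ y → V M p a ≡ V M p b
    compare true  true  pa pb = trans pa (sym pb)
    compare false false pa pb = trans pa (sym pb)
    compare true  false pa pb = refuted a b Ya Yb pa pb
    compare false true  pa pb = refuted b a Yb Ya pb pa

  -- Conversely, if p is constant on Y then □p ∨ □¬p holds: if □p fails,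
  -- some world lacks p, so by constancy no world has p, i.e. □¬p.
  constant⇒settled : ∀ {Y} v p → Constant Y p → Sat M v Y (settled p)
  constant⇒settled {Y = Y} v p constP (notBoxP , notBoxNotP) = notBoxP boxP
    where
    boxP : ∀ u → Y u → Sat M u Y (atom p)
    boxP u Yu with V M p u in pu
    ... | true  = lift refl
    ... | false = ⊥-elim (notBoxNotP λ u' Yu' pu' →
                    true≢false (trans (sym (lower pu')) (trans (constP u' u Yu' Yu) pu)))

  ⋀-elim : ∀ {A : Set} {v Y} (f : A → Form) x xs →
    Sat M v Y (⋀ (List⁺.map f (x ∷ xs))) → ∀ y → y ∈ toList (x ∷ xs) → Sat M v Y (f y)
  ⋀-elim f x []        fx              y (here refl) = fx
  ⋀-elim f x (x' ∷ xs) (fx , _)        y (here refl) = fx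
  ⋀-elim f x (x' ∷ xs) (_ , conjunct) y (there y∈)  = ⋀-elim f x' xs conjunct y y∈

  ⋀-intro : ∀ {A : Set} {v Y} (f : A → Form) x xs →
    (∀ y → y ∈ toList (x ∷ xs) → Sat M v Y (f y)) → Sat M v Y (⋀ (List⁺.map f (x ∷ xs)))
  ⋀-intro f x []        all-f = all-f x (here refl)
  ⋀-intro f x (x' ∷ xs) all-f = all-f x (here refl) , ⋀-intro f x' xs (λ y y∈ → all-f y (there y∈))

  Antecedent : List⁺ Var → Form
  Antecedent ps = ⋀ (List⁺.map settled ps)

  supports⇒constant : ∀ {Y} ps → Supports M Y (Antecedent ps) →
    ∀ a b → Y a → Y b → AgreeOn ps a b
  supports⇒constant (p ∷ ps) supp a b Ya Yb r r∈ =
    settled⇒constant a r (⋀-elim settled p ps (supp a Ya) r r∈) a b Ya Yb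

  constant⇒supports : ∀ {Y} ps → (∀ a b → Y a → Y b → AgreeOn ps a b) →
    Supports M Y (Antecedent ps)
  constant⇒supports (p ∷ ps) agree u Yu =
    ⋀-intro settled p ps λ r r∈ → constant⇒settled u r λ a b Ya Yb → agree a b Ya Yb r r∈

  cell : State M → List⁺ Var → W M → State M
  cell X ps w u = X u × AgreeOn ps u w

  cell-centre : ∀ X ps w → X w → cell X ps w w
  cell-centre X ps w Xw = Xw , λ _ _ → refl

  -- The cell of a world of X is a maximal admissible state for the
  -- antecedent: it supports it, and any supporting Y ⊆ X that contains the
  -- cell (hence w) is itself contained in the cell, so cannot be strictly larger.
  cell-maxAdmissible : ∀ X ps w → X w → MaxAdmissible M X (Antecedent ps) (cell X ps w)
  cell-maxAdmissible X ps w Xw = (λ _ → proj₁) , supports , maximal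
    where
    supports : Supports M (cell X ps w) (Antecedent ps)
    supports = constant⇒supports ps λ a b (_ , aw) (_ , bw) r r∈ → trans (aw r r∈) (sym (bw r r∈))

    maximal : ∀ Y → Y ⊆ X → Supports M Y (Antecedent ps) → ¬ (cell X ps w ⊊ Y)
    maximal Y Y⊆X suppY (cell⊆Y , u , Yu , u∉cell) =
      u∉cell (Y⊆X u Yu , supports⇒constant ps suppY u w Yu (cell⊆Y w (cell-centre X ps w Xw)))

  -- (⇒) On any state Y ⊆ X supporting the antecedent, the pᵢ are constant,
  -- so dependence makes q constant, i.e. settled; in particular on every
  -- maximal admissible Y.
  dependence⇒true : ∀ X q ps → DependsOn M X q ps → TrueIn M X (depFormula q ps)
  dependence⇒true X q ps dep w Y (Y⊆X , suppY , _) v Yv =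
    constant⇒settled v q λ a b Ya Yb →
      dep a b (Y⊆X a Ya) (Y⊆X b Yb) (supports⇒constant ps suppY a b Ya Yb)

  -- (⇐) If w, v ∈ X agree on ps, both lie in the cell of w, which is
  -- maximal admissible; q is settled there, so w and v agree on q.
  true⇒dependence : ∀ X q ps → TrueIn M X (depFormula q ps) → DependsOn M X q ps
  true⇒dependence X q ps true-in w v Xw Xv agree =
    settled⇒constant w q settledOnCell w v (cell-centre X ps w Xw) (Xv , λ r r∈ → sym (agree r r∈))
    where
    settledOnCell : Sat M w (cell X ps w) (settled q)
    settledOnCell = true-in w (cell X ps w) (cell-maxAdmissible X ps w Xw) w (cell-centre X ps w Xw)

proposition1 : (M : Model) (X : State M) (q : Var) (ps : List⁺ Var) →
    DependsOn M X q ps ⇔ TrueIn M X (depFormula q ps)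
proposition1 M X q ps = mk⇔ (dependence⇒true M X q ps) (true⇒dependence M X q ps)
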